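{- Let $(\mathfrak A,\mathfrak B,\mathfrak C)$ be a $2$-color Sturmian lattice. Then any two of the bi-infinite words $(a_i),(b_j),(c_k)\in\{0,1\}^{\mathbb Z}$ are mutually balanced.
   Context: A Sturmian lattice is a triple of real sequences $(a(i)),(b(j)),(c(k))$ indexed by $\mathbb Z$, with consecutive differences (widths) $\ge1$, such that there exists $V\subset\mathbb Z^3$ with $(0,0,0)\in V$, exactly one completing index for every pair of the other two, and $|a(i)+b(j)+c(k)|=\frac12$ for $(i,j,k)\in V$. It is $2$-color if the set of all widths (in all three directions) has at most two elements; then with $\kappa$ the minimal width all widths lie in $\{\kappa,\kappa+1\}$ and one sets $a_i=0$ if $a(i+1)-a(i)=\kappa$, $a_i=1$ if it is $\kappa+1$, and likewise $b_j,c_k$. For a finite word $u$, $|u|_1$ is the number of $1$'s. Two words $x,y$ are mutually balanced if $-1\le|u|_1-|v|_1\le1$ for every factor $u$ of $x$ and factor $v$ of $y$ with $|u|=|v|$. -}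

module Defs where

open import Level using (0ℓ)
open import Data.Bool using (Bool; true; false)
open import Data.Nat as ℕ using (ℕ; zero; suc)
open import Data.Integer as ℤ using (ℤ)
open import Data.Product using (Σ; ∃; _×_; _,_)
open import Data.Sum using (_⊎_)
open import Relation.Binary.PropositionalEquality using (_≡_; _≢_)
open import Relation.Binary.Structures using (IsTotalOrder)
open import Algebra.Structures using (IsCommutativeRing)

-- The real numbers, axiomatised as a complete ordered field
-- (any model of these axioms is isomorphic to ℝ).

record RealField : Set₁ where
  infixl 6 _+_
  infixl 7 _*_
  infix  8 -_
  infix  4 _≤_
  field
    Carrier : Set
    _+_ _*_ : Carrier → Carrier → Carrier
    -_      : Carrier → Carrier
    0# 1#   : Carrier
    isCommutativeRing : IsCommutativeRing _≡_ _+_ _*_ -_ 0# 1#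
    0≢1     : 0# ≢ 1#
    inverse : ∀ x → x ≢ 0# → ∃ λ y → x * y ≡ 1#
    _≤_     : Carrier → Carrier → Set
    isTotalOrder : IsTotalOrder _≡_ _≤_
    +-mono-≤ : ∀ {x y} z → x ≤ y → x + z ≤ y + z
    *-nonneg : ∀ {x y} → 0# ≤ x → 0# ≤ y → 0# ≤ x * y
    complete : (P : Carrier → Set) → ∃ P → (∃ λ u → ∀ x → P x → x ≤ u) →
               ∃ λ s → (∀ x → P x → x ≤ s) ×
                       (∀ u → (∀ x → P x → x ≤ u) → s ≤ u)

  _-_ : Carrier → Carrier → Carrier
  x - y = x + (- y)

module _ (R : RealField) where
  open RealField R

  -- |x| = 1/2, written as 2x = 1 or 2x = -1
  AbsHalf : Carrier → Set
  AbsHalf x = (x + x ≡ 1#) ⊎ (x + x ≡ - 1#)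

  width : (ℤ → Carrier) → ℤ → Carrier
  width a i = a (i ℤ.+ ℤ.1ℤ) - a i

  ExactlyOne : (ℤ → Set) → Set
  ExactlyOne P = ∃ λ k → P k × (∀ k′ → P k′ → k′ ≡ k)

  record IsSturmianLattice (a b c : ℤ → Carrier) : Set₁ where
    field
      width-a : ∀ i → 1# ≤ width a i
      width-b : ∀ j → 1# ≤ width b j
      width-c : ∀ k → 1# ≤ width c k
      V       : ℤ → ℤ → ℤ → Set
      origin  : V ℤ.0ℤ ℤ.0ℤ ℤ.0ℤ
      unique-k : ∀ i j → ExactlyOne (λ k → V i j k)
      unique-j : ∀ i k → ExactlyOne (λ j → V i j k)
      unique-i : ∀ j k → ExactlyOne (λ i → V i j k)
      half    : ∀ i j k → V i j k → AbsHalf (a i + b j + c k)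

  IsWidth : (a b c : ℤ → Carrier) → Carrier → Set
  IsWidth a b c w = (∃ λ i → w ≡ width a i) ⊎ (∃ λ j → w ≡ width b j)
                  ⊎ (∃ λ k → w ≡ width c k)

  IsTwoColor : (a b c : ℤ → Carrier) → Set
  IsTwoColor a b c = ∀ w₁ w₂ w₃ → IsWidth a b c w₁ → IsWidth a b c w₂ →
                     IsWidth a b c w₃ → (w₁ ≡ w₂) ⊎ (w₁ ≡ w₃) ⊎ (w₂ ≡ w₃)

  IsMinWidth : (a b c : ℤ → Carrier) → Carrier → Set
  IsMinWidth a b c κ = IsWidth a b c κ × (∀ w → IsWidth a b c w → κ ≤ w)

  -- x is the 0/1 word (false = 0, true = 1) coding the widths of a w.r.t. κ:
  -- letter 0 iff width κ, letter 1 iff width κ+1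
  Codes : Carrier → (ℤ → Carrier) → (ℤ → Bool) → Set
  Codes κ a x = ∀ i → (x i ≡ false × width a i ≡ κ) ⊎ (x i ≡ true × width a i ≡ κ + 1#)

ones : (ℤ → Bool) → ℤ → ℕ → ℕ
ones x i zero    = zero
ones x i (suc n) with x i
... | true  = suc (ones x (i ℤ.+ ℤ.1ℤ) n)
... | false = ones x (i ℤ.+ ℤ.1ℤ) n

-- mutually balanced: -1 ≤ |u|₁ - |v|₁ ≤ 1 for equal-length factors
MutuallyBalanced : (ℤ → Bool) → (ℤ → Bool) → Set
MutuallyBalanced x y = ∀ i j n → (ones x i n ℕ.≤ suc (ones y j n)) × (ones y j n ℕ.≤ suc (ones x i n))

{-# OPTIONS --safe #-}

-- Fix the third index k. On the slice V(·,·,k) the completing index j = φ(i) is a bijection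
-- of ℤ, and φ(i + 1) < φ(i): otherwise a(i) + b(φ(i)) would grow by at least 2 between two
-- points where a + b + c(k) is ±1/2. A strictly decreasing bijection of ℤ moves down by
-- exactly one at each step, so (i, j + n) ∈ V forces (i + n, j) ∈ V. Both a(i) + b(j + n) + c(k)
-- and a(i + n) + b(j) + c(k) are then ±1/2, and their difference is |v|₁ - |u|₁ for the factors
-- u = a_i … a_{i+n-1} and v = b_j … b_{j+n-1} (the n κ parts cancel), so it lies in {-1, 0, 1}.
-- The other two pairs follow by permuting the roles of the three sequences.
module Submission where

open import Defs
open import Level using (0ℓ)
open import Function using (flip)
open import Data.Bool using (Bool; true; false)
open import Data.Nat as ℕ using (zero; suc; z≤n; s≤s)
import Data.Nat.Properties as ℕP
open import Data.Integer as ℤ using (ℤ; 1ℤ)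
import Data.Integer.Properties as ℤP
open import Data.Integer.Tactic.RingSolver using (solve-∀)
open import Data.Product using (_×_; _,_; ∃; proj₁; proj₂)
open import Data.Sum using (inj₁; inj₂)
open import Data.Maybe using (nothing)
open import Relation.Binary.PropositionalEquality
open import Relation.Binary.Definitions using (Reflexive; Transitive; tri<; tri≈; tri>)
open import Relation.Binary.Structures using (IsTotalOrder)
open import Relation.Binary.Bundles using (Poset)
import Relation.Binary.Reasoning.PartialOrder
open import Relation.Nullary using (¬_; contradiction)
open import Algebra.Bundles using (CommutativeRing)
import Algebra.Properties.AbelianGroup as AbelianGroupProperties
import Algebra.Properties.CommutativeSemigroup as CommutativeSemigroupProperties
import Algebra.Properties.Ring as RingProperties
import Algebra.Definitions.RawMonoid as RawMonoidDefinitions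
open import Tactic.RingSolver.Core.AlmostCommutativeRing using (fromCommutativeRing)
import Tactic.RingSolver.NonReflective as RingSolver

open AbelianGroupProperties ℤP.+-0-abelianGroup using () renaming (∙-cancelʳ to ℤ+-cancelʳ)

module _ where
  open import Data.Integer using (+_; _+_; _-_; _≤_; _<_)

  i<i+1 : ∀ i → i < i + 1ℤ
  i<i+1 i = ℤP.suc[i]≤j⇒i<j (ℤP.≤-reflexive (ℤP.+-comm 1ℤ i))

  i<j⇒i+1≤j : ∀ {i j} → i < j → i + 1ℤ ≤ j
  i<j⇒i+1≤j {i} i<j = subst (_≤ _) (ℤP.+-comm 1ℤ i) (ℤP.i<j⇒suc[i]≤j i<j)

  i≤j⇒∃[n]i+n≡j : ∀ {i j} → i ≤ j → ∃ λ n → i + + n ≡ j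
  i≤j⇒∃[n]i+n≡j {i} {j} i≤j =
    ℤ.∣ i - j ∣ , trans (cong (_+_ i) (ℤP.∣-∣-≤ i≤j)) (i+[j-i]≡j i j)
    where
    i+[j-i]≡j : ∀ i j → i + (j - i) ≡ j
    i+[j-i]≡j = solve-∀

  module StepwiseMonotone {a ℓ} {A : Set a} {_≼_ : A → A → Set ℓ}
    (≼-refl : Reflexive _≼_) (≼-trans : Transitive _≼_)
    (f : ℤ → A) (step : ∀ i → f i ≼ f (i + 1ℤ)) where

    f[i]≼f[i+n] : ∀ i n → f i ≼ f (i + + n)
    f[i]≼f[i+n] i zero = subst (λ k → f i ≼ f k) (sym (ℤP.+-identityʳ i)) ≼-refl
    f[i]≼f[i+n] i (suc n) = ≼-trans (step i)
      (subst (λ k → f (i + 1ℤ) ≼ f k) (ℤP.+-assoc i 1ℤ (+ n)) (f[i]≼f[i+n] (i + 1ℤ) n))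

    monotone : ∀ {i j} → i ≤ j → f i ≼ f j
    monotone {i} i≤j with i≤j⇒∃[n]i+n≡j i≤j
    ... | n , refl = f[i]≼f[i+n] i n

  module DecreasingSurjection (f : ℤ → ℤ)
    (decreasing : ∀ i → f (i + 1ℤ) < f i) (surjective : ∀ j → ∃ λ i → f i ≡ j) where

    antitone : ∀ {i j} → i ≤ j → f j ≤ f i
    antitone = StepwiseMonotone.monotone {_≼_ = flip _≤_} ℤP.≤-refl (flip ℤP.≤-trans) f
      (λ i → ℤP.<⇒≤ (decreasing i))

    -- The value just above f (i + 1) is taken at some i′ ≤ i, which squeezes f i onto it.
    1+f[i+1]≡f[i] : ∀ i → ℤ.suc (f (i + 1ℤ)) ≡ f i
    1+f[i+1]≡f[i] i =
      ℤP.≤-antisym (ℤP.i<j⇒suc[i]≤j (decreasing i)) (subst (f i ≤_) f[i′]≡v (antitone i′≤i))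
      where
      v = ℤ.suc (f (i + 1ℤ))
      i′ = proj₁ (surjective v)
      f[i′]≡v = proj₂ (surjective v)
      i′≤i : i′ ≤ i
      i′≤i = ℤP.≮⇒≥ λ i<i′ → ℤP.<-irrefl refl
        (ℤP.≤-<-trans (antitone (i<j⇒i+1≤j i<i′))
          (subst (f (i + 1ℤ) <_) (sym f[i′]≡v) (ℤP.suc[i]≤j⇒i<j ℤP.≤-refl)))

    f[i+n]+n≡f[i] : ∀ i n → f (i + + n) + + n ≡ f i
    f[i+n]+n≡f[i] i zero = trans (ℤP.+-identityʳ _) (cong f (ℤP.+-identityʳ i))
    f[i+n]+n≡f[i] i (suc n) = begin
      f (i + + suc n) + + suc n         ≡⟨ cong (λ k → f k + + suc n) (ℤP.+-assoc i 1ℤ (+ n)) ⟨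
      f (i + 1ℤ + + n) + (1ℤ + + n)     ≡⟨ x+[1+m]≡1+[x+m] (f (i + 1ℤ + + n)) (+ n) ⟩
      ℤ.suc (f (i + 1ℤ + + n) + + n)    ≡⟨ cong ℤ.suc (f[i+n]+n≡f[i] (i + 1ℤ) n) ⟩
      ℤ.suc (f (i + 1ℤ))                ≡⟨ 1+f[i+1]≡f[i] i ⟩
      f i                               ∎
      where
      open ≡-Reasoning
      x+[1+m]≡1+[x+m] : ∀ x m → x + (1ℤ + m) ≡ 1ℤ + (x + m)
      x+[1+m]≡1+[x+m] = solve-∀

module _ (R : RealField) where
  open RealField R
  open IsTotalOrder isTotalOrder using (total; antisym)
    renaming (refl to ≤-refl; trans to ≤-trans; isPartialOrder to ≤-isPartialOrder)

  commutativeRing : CommutativeRing 0ℓ 0ℓ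
  commutativeRing = record { isCommutativeRing = isCommutativeRing }

  open CommutativeRing commutativeRing
    using (+-comm; +-assoc; +-identityˡ; +-identityʳ; -‿inverseˡ; -‿inverseʳ)
  open AbelianGroupProperties (CommutativeRing.+-abelianGroup commutativeRing)
    using (\\-leftDividesʳ; //-rightDividesˡ; ⁻¹-involutive)
  open CommutativeSemigroupProperties (CommutativeRing.+-commutativeSemigroup commutativeRing)
    using (interchange; xy∙z≈xz∙y; xy∙z≈yz∙x)
  open RingProperties (CommutativeRing.ring commutativeRing) using (-1*x≈-x)
  open RawMonoidDefinitions (CommutativeRing.+-rawMonoid commutativeRing) using () renaming (_×_ to _·_)
  open RingSolver (fromCommutativeRing commutativeRing (λ _ → nothing))

  ≤-poset : Poset 0ℓ 0ℓ 0ℓ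
  ≤-poset = record { isPartialOrder = ≤-isPartialOrder }

  2# : Carrier
  2# = 1# + 1#

  +-monoʳ-≤ : ∀ z {x y} → x ≤ y → z + x ≤ z + y
  +-monoʳ-≤ z {x} {y} x≤y = subst₂ _≤_ (+-comm x z) (+-comm y z) (+-mono-≤ z x≤y)

  +-mono₂-≤ : ∀ {x y u v} → x ≤ y → u ≤ v → x + u ≤ y + v
  +-mono₂-≤ {y = y} {u} x≤y u≤v = ≤-trans (+-mono-≤ u x≤y) (+-monoʳ-≤ y u≤v)

  +-cancelˡ-≤ : ∀ z {x y} → z + x ≤ z + y → x ≤ y
  +-cancelˡ-≤ z {x} {y} h = subst₂ _≤_ (\\-leftDividesʳ z x) (\\-leftDividesʳ z y) (+-monoʳ-≤ (- z) h)

  -- If 1 ≤ 0 then 0 ≤ -1, hence 0 ≤ (-1)(-1) = 1 anyway.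
  0≤1 : 0# ≤ 1#
  0≤1 with total 0# 1#
  ... | inj₁ 0≤1 = 0≤1
  ... | inj₂ 1≤0 = subst (0# ≤_) [-1][-1]≡1 (*-nonneg 0≤-1 0≤-1)
    where
    0≤-1 : 0# ≤ - 1#
    0≤-1 = subst₂ _≤_ (-‿inverseʳ 1#) (+-identityˡ (- 1#)) (+-mono-≤ (- 1#) 1≤0)
    [-1][-1]≡1 : - 1# * - 1# ≡ 1#
    [-1][-1]≡1 = trans (-1*x≈-x (- 1#)) (⁻¹-involutive 1#)

  x≤x+1 : ∀ x → x ≤ x + 1#
  x≤x+1 x = subst (_≤ x + 1#) (+-identityʳ x) (+-monoʳ-≤ x 0≤1)

  -1≤1 : - 1# ≤ 1#
  -1≤1 = ≤-trans (subst₂ _≤_ (+-identityʳ (- 1#)) (-‿inverseˡ 1#) (+-monoʳ-≤ (- 1#) 0≤1)) 0≤1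

  2≰0 : ¬ (2# ≤ 0#)
  2≰0 2≤0 = 0≢1 (antisym 0≤1 (≤-trans (x≤x+1 1#) 2≤0))

  absHalf-bounds : ∀ {s} → AbsHalf R s → (- 1# ≤ s + s) × (s + s ≤ 1#)
  absHalf-bounds (inj₁ s+s≡1)  = subst (- 1# ≤_) (sym s+s≡1) -1≤1 , subst (_≤ 1#) (sym s+s≡1) ≤-refl
  absHalf-bounds (inj₂ s+s≡-1) = subst (- 1# ≤_) (sym s+s≡-1) ≤-refl , subst (_≤ 1#) (sym s+s≡-1) -1≤1

  absHalf-gap : ∀ {s t} → AbsHalf R s → AbsHalf R t → ¬ (s + 2# ≤ t)
  absHalf-gap {s} {t} hs ht s+2≤t = 2≰0 (+-cancelˡ-≤ 1# (begin
    1# + 2#                  ≡⟨ \\-leftDividesʳ 1# (1# + 2#) ⟨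
    - 1# + (1# + (1# + 2#))  ≡⟨ cong (- 1# +_) (+-assoc 1# 1# 2#) ⟨
    - 1# + (2# + 2#)         ≤⟨ +-mono-≤ (2# + 2#) (proj₁ (absHalf-bounds hs)) ⟩
    (s + s) + (2# + 2#)      ≡⟨ interchange s s 2# 2# ⟩
    (s + 2#) + (s + 2#)      ≤⟨ +-mono₂-≤ s+2≤t s+2≤t ⟩
    t + t                    ≤⟨ proj₂ (absHalf-bounds ht) ⟩
    1#                       ≡⟨ +-identityʳ 1# ⟨
    1# + 0#                  ∎))
    where open Relation.Binary.Reasoning.PartialOrder ≤-poset

  ·1-nonneg : ∀ n → 0# ≤ n · 1#
  ·1-nonneg zero    = ≤-refl
  ·1-nonneg (suc n) = subst (_≤ 1# + n · 1#) (+-identityʳ 0#) (+-mono₂-≤ 0≤1 (·1-nonneg n))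

  ·1-mono : ∀ {m n} → m ℕ.≤ n → m · 1# ≤ n · 1#
  ·1-mono {n = n} z≤n = ·1-nonneg n
  ·1-mono (s≤s m≤n)   = +-monoʳ-≤ 1# (·1-mono m≤n)

  absHalf-offsets : ∀ {p m n} → AbsHalf R (p + m · 1#) → AbsHalf R (p + n · 1#) → m ℕ.≤ suc n
  absHalf-offsets {p} {m} {n} hm hn = ℕP.≮⇒≥ λ 1+n<m → absHalf-gap hn hm
    (subst (_≤ p + m · 1#) (p+[2+n]≡p+n+2 p (n · 1#) 1#) (+-monoʳ-≤ p (·1-mono 1+n<m)))
    where
    p+[2+n]≡p+n+2 : ∀ p n o → p + (o + (o + n)) ≡ p + n + (o + o)
    p+[2+n]≡p+n+2 = solve 3 (λ p n o → (p ⊕ (o ⊕ (o ⊕ n))) ⊜ ((p ⊕ n) ⊕ (o ⊕ o))) refl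

  width-step : ∀ x i → x (i ℤ.+ 1ℤ) ≡ x i + width R x i
  width-step x i = trans (sym (//-rightDividesˡ (x i) (x (i ℤ.+ 1ℤ)))) (+-comm _ _)

  module WidthAtLeastOne {x : ℤ → Carrier} (wide : ∀ i → 1# ≤ width R x i) where

    step : ∀ i → x i + 1# ≤ x (i ℤ.+ 1ℤ)
    step i = subst (x i + 1# ≤_) (sym (width-step x i)) (+-monoʳ-≤ (x i) (wide i))

    monotone : ∀ {i j} → i ℤ.≤ j → x i ≤ x j
    monotone = StepwiseMonotone.monotone {_≼_ = _≤_} ≤-refl ≤-trans x
      (λ i → ≤-trans (x≤x+1 (x i)) (step i))

    strict : ∀ {i j} → i ℤ.< j → x i + 1# ≤ x j
    strict {i} i<j = ≤-trans (step i) (monotone (i<j⇒i+1≤j i<j))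

  prefix-sum : ∀ {κ x xw} → Codes R κ x xw → ∀ i n →
               x (i ℤ.+ ℤ.+ n) ≡ x i + (n · κ + ones xw i n · 1#)
  prefix-sum {x = x} cx i zero = begin
    x (i ℤ.+ ℤ.+ 0)  ≡⟨ cong x (ℤP.+-identityʳ i) ⟩
    x i              ≡⟨ +-identityʳ (x i) ⟨
    x i + 0#         ≡⟨ cong (x i +_) (+-identityʳ 0#) ⟨
    x i + (0# + 0#)  ∎
    where open ≡-Reasoning
  prefix-sum {κ} {x} {xw} cx i (suc n) = begin
    x (i ℤ.+ ℤ.+ suc n)          ≡⟨ cong x (ℤP.+-assoc i 1ℤ (ℤ.+ n)) ⟨
    x (i ℤ.+ 1ℤ ℤ.+ ℤ.+ n)       ≡⟨ prefix-sum cx (i ℤ.+ 1ℤ) n ⟩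
    x (i ℤ.+ 1ℤ) + (n · κ + O)   ≡⟨ first-letter ⟩
    x i + (suc n · κ + ones xw i (suc n) · 1#) ∎
    where
    open ≡-Reasoning
    O : Carrier
    O = ones xw (i ℤ.+ 1ℤ) n · 1#
    step-by : ∀ {w} → width R x i ≡ w → x (i ℤ.+ 1ℤ) + (n · κ + O) ≡ x i + w + (n · κ + O)
    step-by width≡w = cong (_+ (n · κ + O)) (trans (width-step x i) (cong (x i +_) width≡w))
    first-letter : x (i ℤ.+ 1ℤ) + (n · κ + O) ≡ x i + (suc n · κ + ones xw i (suc n) · 1#)
    first-letter with xw i | cx i
    ... | false | inj₁ (_ , w≡κ) = begin
      x (i ℤ.+ 1ℤ) + (n · κ + O)      ≡⟨ step-by w≡κ ⟩
      x i + κ + (n · κ + O)           ≡⟨ +-assoc (x i) κ _ ⟩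
      x i + (κ + (n · κ + O))         ≡⟨ cong (x i +_) (+-assoc κ (n · κ) O) ⟨
      x i + (κ + n · κ + O)           ∎
    ... | true | inj₂ (_ , w≡κ+1) = begin
      x (i ℤ.+ 1ℤ) + (n · κ + O)      ≡⟨ step-by w≡κ+1 ⟩
      x i + (κ + 1#) + (n · κ + O)    ≡⟨ +-assoc (x i) (κ + 1#) _ ⟩
      x i + (κ + 1# + (n · κ + O))    ≡⟨ cong (x i +_) (interchange κ 1# (n · κ) O) ⟩
      x i + (κ + n · κ + (1# + O))    ∎
    ... | false | inj₂ (() , _)
    ... | true  | inj₁ (() , _)

  module Slice {x y : ℤ → Carrier} {z : Carrier} {W : ℤ → ℤ → Set}
    (x-wide : ∀ i → 1# ≤ width R x i) (y-wide : ∀ j → 1# ≤ width R y j)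
    (unique-right : ∀ i → ExactlyOne R (W i)) (unique-left : ∀ j → ExactlyOne R (λ i → W i j))
    (half : ∀ {i j} → W i j → AbsHalf R (x i + y j + z)) where

    partner : ℤ → ℤ
    partner i = proj₁ (unique-right i)

    W-partner : ∀ i → W i (partner i)
    W-partner i = proj₁ (proj₂ (unique-right i))

    partner-unique : ∀ {i j} → W i j → j ≡ partner i
    partner-unique {i} w = proj₂ (proj₂ (unique-right i)) _ w

    left-unique : ∀ {i i′ j} → W i j → W i′ j → i ≡ i′
    left-unique {j = j} w w′ =
      let (_ , _ , unique) = unique-left j in trans (unique _ w) (sym (unique _ w′))

    partner-surjective : ∀ j → ∃ λ i → partner i ≡ j
    partner-surjective j = let (i , w , _) = unique-left j in i , sym (partner-unique w)

    partner-decreasing : ∀ i → partner (i ℤ.+ 1ℤ) ℤ.< partner i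
    partner-decreasing i with ℤP.<-cmp (partner (i ℤ.+ 1ℤ)) (partner i)
    ... | tri< below _ _ = below
    ... | tri≈ _ same _  = contradiction
      (left-unique (W-partner i) (subst (W _) same (W-partner (i ℤ.+ 1ℤ)))) (ℤP.<⇒≢ (i<i+1 i))
    ... | tri> _ _ above =
      contradiction rise (absHalf-gap (half (W-partner i)) (half (W-partner (i ℤ.+ 1ℤ))))
      where
      regroup : ∀ a b c o → a + o + (b + o) + c ≡ a + b + c + (o + o)
      regroup = solve 4 (λ a b c o → (((a ⊕ o) ⊕ (b ⊕ o)) ⊕ c) ⊜ (((a ⊕ b) ⊕ c) ⊕ (o ⊕ o))) refl
      rise : x i + y (partner i) + z + 2# ≤ x (i ℤ.+ 1ℤ) + y (partner (i ℤ.+ 1ℤ)) + z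
      rise = subst (_≤ x (i ℤ.+ 1ℤ) + y (partner (i ℤ.+ 1ℤ)) + z) (regroup (x i) (y (partner i)) z 1#)
        (+-mono-≤ z (+-mono₂-≤ (WidthAtLeastOne.step x-wide i) (WidthAtLeastOne.strict y-wide above)))

    open DecreasingSurjection partner partner-decreasing partner-surjective using (f[i+n]+n≡f[i])

    shift : ∀ {i j} n → W i (j ℤ.+ ℤ.+ n) → W (i ℤ.+ ℤ.+ n) j
    shift {i} {j} n w = subst (W _) partner≡j (W-partner (i ℤ.+ ℤ.+ n))
      where
      partner≡j : partner (i ℤ.+ ℤ.+ n) ≡ j
      partner≡j = ℤ+-cancelʳ (ℤ.+ n) _ _ (trans (f[i+n]+n≡f[i] i n) (sym (partner-unique w)))

    balanced-at : ∀ {κ xw yw} → Codes R κ x xw → Codes R κ y yw → ∀ {i j} n → W i (j ℤ.+ ℤ.+ n) →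
                  (ones xw i n ℕ.≤ suc (ones yw j n)) × (ones yw j n ℕ.≤ suc (ones xw i n))
    balanced-at {κ} {xw} {yw} cx cy {i} {j} n w = absHalf-offsets hx hy , absHalf-offsets hy hx
      where
      regroupˣ : ∀ a b c k e → a + (k + e) + b + c ≡ a + b + c + k + e
      regroupˣ = solve 5 (λ a b c k e → (((a ⊕ (k ⊕ e)) ⊕ b) ⊕ c) ⊜ ((((a ⊕ b) ⊕ c) ⊕ k) ⊕ e)) refl
      regroupʸ : ∀ a b c k e → a + (b + (k + e)) + c ≡ a + b + c + k + e
      regroupʸ = solve 5 (λ a b c k e → ((a ⊕ (b ⊕ (k ⊕ e))) ⊕ c) ⊜ ((((a ⊕ b) ⊕ c) ⊕ k) ⊕ e)) refl
      hx : AbsHalf R (x i + y j + z + n · κ + ones xw i n · 1#)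
      hx = subst (AbsHalf R)
        (trans (cong (λ t → t + y j + z) (prefix-sum cx i n)) (regroupˣ _ _ _ _ _))
        (half (shift n w))
      hy : AbsHalf R (x i + y j + z + n · κ + ones yw j n · 1#)
      hy = subst (AbsHalf R)
        (trans (cong (λ t → x i + t + z) (prefix-sum cy j n)) (regroupʸ _ _ _ _ _))
        (half w)

  swap₂₃ : ∀ {a b c} → IsSturmianLattice R a b c → IsSturmianLattice R a c b
  swap₂₃ {a} {b} {c} L = record
    { width-a  = width-a
    ; width-b  = width-c
    ; width-c  = width-b
    ; V        = λ i k j → V i j k
    ; origin   = origin
    ; unique-k = unique-j
    ; unique-j = unique-k
    ; unique-i = λ k j → unique-i j k
    ; half     = λ i k j v → subst (AbsHalf R) (xy∙z≈xz∙y (a i) (b j) (c k)) (half i j k v)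
    }
    where open IsSturmianLattice L

  rotate : ∀ {a b c} → IsSturmianLattice R a b c → IsSturmianLattice R b c a
  rotate {a} {b} {c} L = record
    { width-a  = width-b
    ; width-b  = width-c
    ; width-c  = width-a
    ; V        = λ j k i → V i j k
    ; origin   = origin
    ; unique-k = unique-i
    ; unique-j = λ j i → unique-k i j
    ; unique-i = λ k i → unique-j i k
    ; half     = λ j k i v → subst (AbsHalf R) (xy∙z≈yz∙x (a i) (b j) (c k)) (half i j k v)
    }
    where open IsSturmianLattice L

  balanced₁₂ : ∀ {a b c κ aw bw} → IsSturmianLattice R a b c →
               Codes R κ a aw → Codes R κ b bw → MutuallyBalanced aw bw
  balanced₁₂ L ca cb i j n =
    let (k , v , _) = unique-k i (j ℤ.+ ℤ.+ n) in
    Slice.balanced-at width-a width-b (λ i → unique-j i k) (λ j → unique-i j k) (λ {i} {j} → half i j k)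
      ca cb n v
    where open IsSturmianLattice L

proposition3p12 : (R : RealField) (a b c : ℤ → RealField.Carrier R) →
    IsSturmianLattice R a b c → IsTwoColor R a b c →
    (κ : RealField.Carrier R) → IsMinWidth R a b c κ →
    (aw bw cw : ℤ → Bool) →
    Codes R κ a aw → Codes R κ b bw → Codes R κ c cw →
    MutuallyBalanced aw bw × MutuallyBalanced aw cw × MutuallyBalanced bw cw
proposition3p12 R a b c L _ κ _ aw bw cw ca cb cc =
  balanced₁₂ R L ca cb , balanced₁₂ R (swap₂₃ R L) ca cc , balanced₁₂ R (rotate R L) cb cc
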